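{- Let $G$ be a connected graph of order $n\geq 4$ and $C(G)$ its central graph. Then $Aut(G)\cong Aut(C(G))$ as groups.
   Context: All graphs are simple, finite, undirected. The central graph $C(G)$ has vertex set $V(G)\cup\{w_{u,v}:\{u,v\}\in E(G)\}$ and edge set consisting of all pairs of distinct non-adjacent vertices of $G$, together with $\{u,w_{u,v}\}$ and $\{w_{u,v},v\}$ for every $\{u,v\}\in E(G)$. -}

module Defs where

open import Level using (0ℓ)
open import Data.Nat using (ℕ; _<_)
open import Data.Fin using (Fin; toℕ)
open import Data.Bool using (Bool; true; false; T)
open import Data.Product using (Σ; _×_; _,_; proj₁; proj₂)
open import Data.Sum using (_⊎_; inj₁; inj₂)
open import Data.Empty using (⊥)
open import Function using (_∘_; id)
open import Function.Bundles using (_⇔_; mk⇔; Equivalence)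
open import Relation.Nullary using (¬_)
open import Relation.Binary.PropositionalEquality
  using (_≡_; _≢_; refl; sym; trans; cong)
open import Relation.Binary.Construct.Closure.ReflexiveTransitive using (Star)
open import Algebra.Bundles using (Group)

record SimpleGraph (n : ℕ) : Set where
  field
    adj     : Fin n → Fin n → Bool
    adj-sym : ∀ u v → adj u v ≡ adj v u
    adj-irr : ∀ u → adj u u ≡ false

open SimpleGraph public

Adj : ∀ {n} → SimpleGraph n → Fin n → Fin n → Set
Adj G u v = T (adj G u v)

Connected : ∀ {n} → SimpleGraph n → Set
Connected G = ∀ u v → Star (Adj G) u v

record Graph : Set₁ where
  field
    Vtx : Set
    _∼_ : Vtx → Vtx → Set

open Graph public

toGraph : ∀ {n} → SimpleGraph n → Graph
toGraph {n} G = record { Vtx = Fin n ; _∼_ = Adj G }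

-- Edges of G: each edge {u,v} is represented once, by the pair (u , v)
-- with u < v (as natural numbers).
Edge : ∀ {n} → SimpleGraph n → Set
Edge {n} G = Σ (Fin n × Fin n) λ p → (toℕ (proj₁ p) < toℕ (proj₂ p)) × Adj G (proj₁ p) (proj₂ p)

end₁ end₂ : ∀ {n} {G : SimpleGraph n} → Edge G → Fin n
end₁ e = proj₁ (proj₁ e)
end₂ e = proj₂ (proj₁ e)

CAdj : ∀ {n} (G : SimpleGraph n) → Fin n ⊎ Edge G → Fin n ⊎ Edge G → Set
CAdj G (inj₁ u) (inj₁ v) = (u ≢ v) × ¬ Adj G u v
CAdj G (inj₁ u) (inj₂ e) = (u ≡ end₁ {G = G} e) ⊎ (u ≡ end₂ {G = G} e)
CAdj G (inj₂ e) (inj₁ u) = (u ≡ end₁ {G = G} e) ⊎ (u ≡ end₂ {G = G} e)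
CAdj G (inj₂ e) (inj₂ f) = ⊥

Central : ∀ {n} → SimpleGraph n → Graph
Central {n} G = record { Vtx = Fin n ⊎ Edge G ; _∼_ = CAdj G }

record Automorphism (H : Graph) : Set where
  field
    to        : Vtx H → Vtx H
    from      : Vtx H → Vtx H
    from-to   : ∀ x → from (to x) ≡ x
    to-from   : ∀ x → to (from x) ≡ x
    preserves : ∀ x y → _∼_ H x y ⇔ _∼_ H (to x) (to y)

open Automorphism public

module _ (H : Graph) where

  _≈ᴬ_ : Automorphism H → Automorphism H → Set
  f ≈ᴬ g = ∀ x → to f x ≡ to g x

  idᴬ : Automorphism H
  idᴬ = record
    { to = id ; from = id ; from-to = λ _ → refl ; to-from = λ _ → refl
    ; preserves = λ x y → mk⇔ id id }

  _∘ᴬ_ : Automorphism H → Automorphism H → Automorphism H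
  f ∘ᴬ g = record
    { to = to f ∘ to g
    ; from = from g ∘ from f
    ; from-to = λ x → trans (cong (from g) (from-to f (to g x))) (from-to g x)
    ; to-from = λ x → trans (cong (to f) (to-from g (from f x))) (to-from f x)
    ; preserves = λ x y → mk⇔
        (λ p → Equivalence.to (preserves f (to g x) (to g y))
                 (Equivalence.to (preserves g x y) p))
        (λ p → Equivalence.from (preserves g x y)
                 (Equivalence.from (preserves f (to g x) (to g y)) p))
    }

  invᴬ : Automorphism H → Automorphism H
  invᴬ f = record
    { to = from f ; from = to f ; from-to = to-from f ; to-from = from-to f
    ; preserves = λ x y → mk⇔
        (λ p → Equivalence.from (preserves f (from f x) (from f y))
                 (subst2 (to-from f x) (to-from f y) p))
        (λ p → subst2' (to-from f x) (to-from f y)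
                 (Equivalence.to (preserves f (from f x) (from f y)) p))
    }
    where
    subst2 : ∀ {a a' b b'} → a' ≡ a → b' ≡ b → _∼_ H a b → _∼_ H a' b'
    subst2 refl refl p = p
    subst2' : ∀ {a a' b b'} → a ≡ a' → b ≡ b' → _∼_ H a b → _∼_ H a' b'
    subst2' refl refl p = p

  inv-cong : ∀ {f g} → f ≈ᴬ g → invᴬ f ≈ᴬ invᴬ g
  inv-cong {f} {g} e x =
    trans (cong (from f) (sym (to-from g x)))
      (trans (cong (from f) (sym (e (from g x)))) (from-to f (from g x)))

  Aut : Group 0ℓ 0ℓ
  Aut = record
    { Carrier = Automorphism H
    ; _≈_ = _≈ᴬ_
    ; _∙_ = _∘ᴬ_
    ; ε = idᴬ
    ; _⁻¹ = invᴬ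
    ; isGroup = record
      { isMonoid = record
        { isSemigroup = record
          { isMagma = record
            { isEquivalence = record
              { refl = λ _ → refl
              ; sym = λ e x → sym (e x)
              ; trans = λ e₁ e₂ x → trans (e₁ x) (e₂ x) }
            ; ∙-cong = λ {f} {f'} {g} {g'} e₁ e₂ x →
                trans (cong (to f) (e₂ x)) (e₁ (to g' x)) }
          ; assoc = λ _ _ _ _ → refl }
        ; identity = (λ _ _ → refl) , (λ _ _ → refl) }
      ; inverse = (λ f x → from-to f x) , (λ f x → to-from f x)
      ; ⁻¹-cong = λ {f} {g} → inv-cong {f} {g} }
    }

open import Algebra.Morphism.Structures using (module GroupMorphisms)

_≅ᴳ_ : Group 0ℓ 0ℓ → Group 0ℓ 0ℓ → Set
A ≅ᴳ B = Σ (Group.Carrier A → Group.Carrier B) λ φ →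
  GroupMorphisms.IsGroupIsomorphism (Group.rawGroup A) (Group.rawGroup B) φ

{-# OPTIONS --safe #-}
module Submission where

-- A vertex u of G has a neighbour in C(G) towards every other vertex v (v itself if uv ∉ E(G),
-- the subdivision vertex w_{u,v} otherwise), hence n − 1 ≥ 3 distinct neighbours, whereas
-- w_{u,v} has only the two neighbours u and v.  So an automorphism of C(G) maps V(G) onto V(G),
-- and it restricts to an automorphism of G because distinct vertices are adjacent in G exactly
-- when they are non-adjacent in C(G).  Conversely an automorphism of G acts on the edges, and
-- extending and restricting are mutually inverse.

open import Defs
open import Data.Nat using (ℕ; _≥_; s≤s)
open import Data.Nat.Properties using (<-cmp; <-asym; <-irrefl; <-irrelevant)
open import Data.Bool using (T)
open import Data.Bool.Properties using (T-irrelevant)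
open import Data.Fin using (Fin; toℕ; zero; suc; punchIn)
open import Data.Fin.Properties using (toℕ-injective; punchIn-injective; punchInᵢ≢i)
open import Data.Unit using (⊤; tt)
open import Data.Product using (_×_; _,_; proj₁; proj₂; ∃)
open import Data.Product.Function.NonDependent.Propositional using (_×-⇔_)
open import Data.Sum using (_⊎_; inj₁; inj₂; swap)
import Data.Sum as Sum
open import Data.Sum.Properties using (inj₁-injective; inj₂-injective)
open import Data.Empty using (⊥-elim)
open import Function using (_∘_; id)
open import Function.Bundles using (_⇔_; mk⇔; Equivalence)
import Function.Properties.Equivalence as ⇔
open import Function.Related.TypeIsomorphisms using (¬-cong-⇔)
open import Relation.Nullary using (¬_; yes; no)
open import Relation.Nullary.Decidable using (T?; decidable-stable)
open import Relation.Binary.Definitions using (tri<; tri≈; tri>)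
open import Relation.Binary.PropositionalEquality
  using (_≡_; _≢_; refl; sym; trans; cong; cong₂; subst; subst₂; module ≡-Reasoning)
open import Algebra.Bundles using (Group)
open import Algebra.Morphism.Structures using (module GroupMorphisms)

record ThreeDistinct {A : Set} (P : A → Set) : Set where
  constructor three
  field
    {x y z} : A
    x≢y : x ≢ y
    x≢z : x ≢ z
    y≢z : y ≢ z
    px : P x
    py : P y
    pz : P z

ThreeDistinct-map : ∀ {A B : Set} {P : A → Set} {Q : B → Set} (f : A → B) →
  (∀ {a a'} → f a ≡ f a' → a ≡ a') → (∀ {a} → P a → Q (f a)) →
  ThreeDistinct P → ThreeDistinct Q
ThreeDistinct-map f f-inj P⇒Q (three x≢y x≢z y≢z px py pz) =
  three (x≢y ∘ f-inj) (x≢z ∘ f-inj) (y≢z ∘ f-inj) (P⇒Q px) (P⇒Q py) (P⇒Q pz)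

¬ThreeDistinct-pair : ∀ {A : Set} {a b : A} → ¬ ThreeDistinct (λ w → w ≡ a ⊎ w ≡ b)
¬ThreeDistinct-pair (three x≢y _   _   (inj₁ refl) (inj₁ refl) _)           = x≢y refl
¬ThreeDistinct-pair (three x≢y _   _   (inj₂ refl) (inj₂ refl) _)           = x≢y refl
¬ThreeDistinct-pair (three _   x≢z _   (inj₁ refl) (inj₂ refl) (inj₁ refl)) = x≢z refl
¬ThreeDistinct-pair (three _   _   y≢z (inj₁ refl) (inj₂ refl) (inj₂ refl)) = y≢z refl
¬ThreeDistinct-pair (three _   _   y≢z (inj₂ refl) (inj₁ refl) (inj₁ refl)) = y≢z refl
¬ThreeDistinct-pair (three _   x≢z _   (inj₂ refl) (inj₁ refl) (inj₂ refl)) = x≢z refl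

three-others : ∀ {n} → n ≥ 4 → (u : Fin n) → ThreeDistinct (_≢ u)
three-others (s≤s (s≤s (s≤s (s≤s _)))) u =
  ThreeDistinct-map {P = λ _ → ⊤} (punchIn u) (punchIn-injective u _ _) (λ {j} _ → punchInᵢ≢i u j)
    (three {x = zero} {suc zero} {suc (suc zero)} (λ ()) (λ ()) (λ ()) tt tt tt)

module _ {H : Graph} (σ : Automorphism H) where

  to-injective : ∀ {x y} → to σ x ≡ to σ y → x ≡ y
  to-injective {x} {y} eq = trans (sym (from-to σ x)) (trans (cong (from σ) eq) (from-to σ y))

  preserves⇒ : ∀ {x y} → _∼_ H x y → _∼_ H (to σ x) (to σ y)
  preserves⇒ {x} {y} = Equivalence.to (preserves σ x y)

  preserves⇐ : ∀ {x y} → _∼_ H (to σ x) (to σ y) → _∼_ H x y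
  preserves⇐ {x} {y} = Equivalence.from (preserves σ x y)

  ThreeDistinct-neighbours : ∀ {x} → ThreeDistinct (_∼_ H x) → ThreeDistinct (_∼_ H (to σ x))
  ThreeDistinct-neighbours = ThreeDistinct-map (to σ) to-injective preserves⇒

module _ {n : ℕ} (G : SimpleGraph n) where

  Adj-sym : ∀ {x y} → Adj G x y → Adj G y x
  Adj-sym {x} {y} = subst T (adj-sym G x y)

  Adj-distinct : ∀ {x y} → Adj G x y → x ≢ y
  Adj-distinct {x} a refl = subst T (adj-irr G x) a

  Adj⇔distinct×¬CAdj : ∀ {x y} → Adj G x y ⇔ (x ≢ y × ¬ CAdj G (inj₁ x) (inj₁ y))
  Adj⇔distinct×¬CAdj {x} {y} = mk⇔
    (λ a → Adj-distinct a , λ c → proj₂ c a)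
    (λ { (x≢y , ¬c) → decidable-stable (T? (adj G x y)) (λ ¬a → ¬c (x≢y , ¬a)) })

  e₁ e₂ : Edge G → Fin n
  e₁ = end₁ {G = G}
  e₂ = end₂ {G = G}

  ends-Adj : ∀ e → Adj G (e₁ e) (e₂ e)
  ends-Adj e = proj₂ (proj₂ e)

  ends-distinct : ∀ e → e₁ e ≢ e₂ e
  ends-distinct (_ , lt , _) eq = <-irrefl (cong toℕ eq) lt

  -- Definitionally CAdj G (inj₁ z) (inj₂ e).
  Incident : Fin n → Edge G → Set
  Incident z e = z ≡ e₁ e ⊎ z ≡ e₂ e

  data Joins (e : Edge G) (x y : Fin n) : Set where
    in-order : e₁ e ≡ x → e₂ e ≡ y → Joins e x y
    swapped  : e₁ e ≡ y → e₂ e ≡ x → Joins e x y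

  joins-ends : ∀ e → Joins e (e₁ e) (e₂ e)
  joins-ends e = in-order refl refl

  joins-sym : ∀ {e x y} → Joins e x y → Joins e y x
  joins-sym (in-order p q) = swapped p q
  joins-sym (swapped p q)  = in-order p q

  edge : ∀ x y → Adj G x y → Edge G
  edge x y a with <-cmp (toℕ x) (toℕ y)
  ... | tri< x<y _ _ = (x , y) , x<y , a
  ... | tri≈ _ x≡y _ = ⊥-elim (Adj-distinct a (toℕ-injective x≡y))
  ... | tri> _ _ y<x = (y , x) , y<x , Adj-sym a

  edge-joins : ∀ x y a → Joins (edge x y a) x y
  edge-joins x y a with <-cmp (toℕ x) (toℕ y)
  ... | tri< _ _ _   = in-order refl refl
  ... | tri≈ _ x≡y _ = ⊥-elim (Adj-distinct a (toℕ-injective x≡y))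
  ... | tri> _ _ _   = swapped refl refl

  joins-unique : ∀ {e e' x y} → Joins e x y → Joins e' x y → e ≡ e'
  joins-unique {(x , y) , x<y , a} {_ , x<y' , a'} (in-order refl refl) (in-order refl refl) =
    cong₂ (λ lt b → (x , y) , lt , b) (<-irrelevant x<y x<y') (T-irrelevant a a')
  joins-unique {(x , y) , x<y , a} {_ , x<y' , a'} (swapped refl refl) (swapped refl refl) =
    cong₂ (λ lt b → (x , y) , lt , b) (<-irrelevant x<y x<y') (T-irrelevant a a')
  joins-unique {_ , x<y , _} {_ , y<x , _} (in-order refl refl) (swapped refl refl) =
    ⊥-elim (<-asym x<y y<x)
  joins-unique {_ , y<x , _} {_ , x<y , _} (swapped refl refl) (in-order refl refl) =
    ⊥-elim (<-asym y<x x<y)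

  joins-injective : ∀ {e u v v'} → Joins e u v → Joins e u v' → v ≡ v'
  joins-injective     (in-order _ q) (in-order _ q') = trans (sym q) q'
  joins-injective     (swapped p _)  (swapped p' _)  = trans (sym p) p'
  joins-injective {e} (in-order p _) (swapped _ q')  = ⊥-elim (ends-distinct e (trans p (sym q')))
  joins-injective {e} (swapped _ q)  (in-order p' _) = ⊥-elim (ends-distinct e (trans p' (sym q)))

  joins⇒incident⇔ : ∀ {e x y z} → Joins e x y → Incident z e ⇔ (z ≡ x ⊎ z ≡ y)
  joins⇒incident⇔ (in-order refl refl) = ⇔.refl
  joins⇒incident⇔ (swapped refl refl) = mk⇔ swap swap

  incident⇒joins : ∀ {e x y} → x ≢ y → Incident x e → Incident y e → Joins e x y
  incident⇒joins x≢y (inj₁ p) (inj₁ q) = ⊥-elim (x≢y (trans p (sym q)))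
  incident⇒joins _   (inj₁ p) (inj₂ q) = in-order (sym p) (sym q)
  incident⇒joins _   (inj₂ p) (inj₁ q) = swapped (sym q) (sym p)
  incident⇒joins x≢y (inj₂ p) (inj₂ q) = ⊥-elim (x≢y (trans p (sym q)))

  toward : Fin n → Fin n → Fin n ⊎ Edge G
  toward u v with T? (adj G u v)
  ... | yes a = inj₂ (edge u v a)
  ... | no _  = inj₁ v

  toward-CAdj : ∀ {u v} → v ≢ u → CAdj G (inj₁ u) (toward u v)
  toward-CAdj {u} {v} v≢u with T? (adj G u v)
  ... | yes a = Equivalence.from (joins⇒incident⇔ {edge u v a} {z = u} (edge-joins u v a)) (inj₁ refl)
  ... | no ¬a = v≢u ∘ sym , ¬a

  toward-injective : ∀ {u v v'} → toward u v ≡ toward u v' → v ≡ v'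
  toward-injective {u} {v} {v'} with T? (adj G u v) | T? (adj G u v')
  ... | yes a | yes a' = λ eq → joins-injective {edge u v a} (edge-joins u v a)
                                  (subst (λ e → Joins e u v') (sym (inj₂-injective eq)) (edge-joins u v' a'))
  ... | yes _ | no _   = λ ()
  ... | no _  | yes _  = λ ()
  ... | no _  | no _   = inj₁-injective

  vertex-ThreeDistinct : n ≥ 4 → ∀ u → ThreeDistinct (CAdj G (inj₁ u))
  vertex-ThreeDistinct n≥4 u = ThreeDistinct-map (toward u) toward-injective toward-CAdj (three-others n≥4 u)

  ¬edge-ThreeDistinct : ∀ e → ¬ ThreeDistinct (CAdj G (inj₂ e))
  ¬edge-ThreeDistinct e = ¬ThreeDistinct-pair ∘ ThreeDistinct-map id id neighbour
    where
    neighbour : ∀ {y} → CAdj G (inj₂ e) y → y ≡ inj₁ (e₁ e) ⊎ y ≡ inj₁ (e₂ e)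
    neighbour {inj₁ _} (inj₁ refl) = inj₁ refl
    neighbour {inj₁ _} (inj₂ refl) = inj₂ refl

  mapEdge : Automorphism (toGraph G) → Edge G → Edge G
  mapEdge f e = edge (to f (e₁ e)) (to f (e₂ e)) (preserves⇒ f (ends-Adj e))

  mapEdge-joins : ∀ f {e x y} → Joins e x y → Joins (mapEdge f e) (to f x) (to f y)
  mapEdge-joins f (in-order refl refl) = edge-joins _ _ _
  mapEdge-joins f (swapped refl refl) = joins-sym (edge-joins _ _ _)

  mapEdge-unique : ∀ f e {e'} → Joins e' (to f (e₁ e)) (to f (e₂ e)) → mapEdge f e ≡ e'
  mapEdge-unique f e = joins-unique (mapEdge-joins f (joins-ends e))

  liftTo : Automorphism (toGraph G) → Fin n ⊎ Edge G → Fin n ⊎ Edge G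
  liftTo f (inj₁ u) = inj₁ (to f u)
  liftTo f (inj₂ e) = inj₂ (mapEdge f e)

  liftTo-id : ∀ {f} → (∀ u → to f u ≡ u) → ∀ x → liftTo f x ≡ x
  liftTo-id f≗id (inj₁ u) = cong inj₁ (f≗id u)
  liftTo-id {f} f≗id (inj₂ e) =
    cong inj₂ (mapEdge-unique f e (subst₂ (Joins e) (sym (f≗id _)) (sym (f≗id _)) (joins-ends e)))

  liftTo-∘ : ∀ {f g h} → (∀ u → to h u ≡ to f (to g u)) →
    ∀ x → liftTo h x ≡ liftTo f (liftTo g x)
  liftTo-∘ h≗fg (inj₁ u) = cong inj₁ (h≗fg u)
  liftTo-∘ {f} {g} {h} h≗fg (inj₂ e) =
    cong inj₂ (mapEdge-unique h e (subst₂ (Joins (mapEdge f (mapEdge g e))) (sym (h≗fg _)) (sym (h≗fg _))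
      (mapEdge-joins f (mapEdge-joins g (joins-ends e)))))

  liftTo-inverse : ∀ {f g} → (∀ u → to g (to f u) ≡ u) → ∀ x → liftTo g (liftTo f x) ≡ x
  liftTo-inverse {f} {g} g∘f≗id x =
    trans (sym (liftTo-∘ {g} {f} {idᴬ _} (sym ∘ g∘f≗id) x)) (liftTo-id {idᴬ _} (λ _ → refl) x)

  liftTo-cong : ∀ {f g} → (∀ u → to f u ≡ to g u) → ∀ x → liftTo f x ≡ liftTo g x
  liftTo-cong {f} {g} f≗g x =
    trans (liftTo-∘ {g} {idᴬ _} {f} f≗g x) (cong (liftTo g) (liftTo-id {idᴬ _} (λ _ → refl) x))

  incident-mapEdge : ∀ f u e → Incident u e ⇔ Incident (to f u) (mapEdge f e)
  incident-mapEdge f u e = ⇔.trans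
    (mk⇔ (Sum.map (cong (to f)) (cong (to f))) (Sum.map (to-injective f) (to-injective f)))
    (⇔.sym (joins⇒incident⇔ {mapEdge f e} (mapEdge-joins f (joins-ends e))))

  liftTo-preserves : ∀ f x y → CAdj G x y ⇔ CAdj G (liftTo f x) (liftTo f y)
  liftTo-preserves f (inj₁ u) (inj₁ v) =
    mk⇔ (_∘ to-injective f) (_∘ cong (to f)) ×-⇔ ¬-cong-⇔ (preserves f u v)
  liftTo-preserves f (inj₁ u) (inj₂ e) = incident-mapEdge f u e
  liftTo-preserves f (inj₂ e) (inj₁ u) = incident-mapEdge f u e
  liftTo-preserves f (inj₂ _) (inj₂ _) = ⇔.refl

  lift : Automorphism (toGraph G) → Automorphism (Central G)
  lift f = record
    { to        = liftTo f
    ; from      = liftTo (invᴬ _ f)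
    ; from-to   = liftTo-inverse (from-to f)
    ; to-from   = liftTo-inverse (to-from f)
    ; preserves = liftTo-preserves f
    }

  module _ (n≥4 : n ≥ 4) where

    vertex↛edge : ∀ (σ : Automorphism (Central G)) u e → to σ (inj₁ u) ≢ inj₂ e
    vertex↛edge σ u e eq = ¬edge-ThreeDistinct e
      (subst (ThreeDistinct ∘ CAdj G) eq (ThreeDistinct-neighbours σ (vertex-ThreeDistinct n≥4 u)))

    vertex↦vertex : ∀ (σ : Automorphism (Central G)) u → ∃ λ v → to σ (inj₁ u) ≡ inj₁ v
    vertex↦vertex σ u with to σ (inj₁ u) in eq
    ... | inj₁ v = v , refl
    ... | inj₂ e = ⊥-elim (vertex↛edge σ u e eq)

    edge↦edge : ∀ (σ : Automorphism (Central G)) e → ∃ λ e' → to σ (inj₂ e) ≡ inj₂ e'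
    edge↦edge σ e with to σ (inj₂ e) in eq
    ... | inj₂ e' = e' , refl
    ... | inj₁ u  = ⊥-elim (vertex↛edge (invᴬ _ σ) u e
                      (trans (cong (from σ) (sym eq)) (from-to σ (inj₂ e))))

    restrictTo : Automorphism (Central G) → Fin n → Fin n
    restrictTo σ u = proj₁ (vertex↦vertex σ u)

    restrictTo-spec : ∀ σ u → to σ (inj₁ u) ≡ inj₁ (restrictTo σ u)
    restrictTo-spec σ u = proj₂ (vertex↦vertex σ u)

    restrictTo-inverse : ∀ σ τ → (∀ x → to τ (to σ x) ≡ x) → ∀ u → restrictTo τ (restrictTo σ u) ≡ u
    restrictTo-inverse σ τ τ∘σ≗id u = inj₁-injective (begin
      inj₁ (restrictTo τ (restrictTo σ u)) ≡⟨ sym (restrictTo-spec τ (restrictTo σ u)) ⟩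
      to τ (inj₁ (restrictTo σ u))         ≡⟨ cong (to τ) (sym (restrictTo-spec σ u)) ⟩
      to τ (to σ (inj₁ u))                 ≡⟨ τ∘σ≗id (inj₁ u) ⟩
      inj₁ u                               ∎)
      where open ≡-Reasoning

    restrictTo-injective : ∀ σ {u v} → restrictTo σ u ≡ restrictTo σ v → u ≡ v
    restrictTo-injective σ {u} {v} eq = inj₁-injective (to-injective σ
      (trans (restrictTo-spec σ u) (trans (cong inj₁ eq) (sym (restrictTo-spec σ v)))))

    restrictTo-preserves-CAdj : ∀ σ u v →
      CAdj G (inj₁ u) (inj₁ v) ⇔ CAdj G (inj₁ (restrictTo σ u)) (inj₁ (restrictTo σ v))
    restrictTo-preserves-CAdj σ u v =
      subst₂ (λ x y → CAdj G (inj₁ u) (inj₁ v) ⇔ CAdj G x y)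
        (restrictTo-spec σ u) (restrictTo-spec σ v) (preserves σ (inj₁ u) (inj₁ v))

    restrictTo-preserves : ∀ σ u v → Adj G u v ⇔ Adj G (restrictTo σ u) (restrictTo σ v)
    restrictTo-preserves σ u v = ⇔.trans Adj⇔distinct×¬CAdj (⇔.trans
      (mk⇔ (_∘ restrictTo-injective σ) (_∘ cong (restrictTo σ)) ×-⇔ ¬-cong-⇔ (restrictTo-preserves-CAdj σ u v))
      (⇔.sym Adj⇔distinct×¬CAdj))

    restrict : Automorphism (Central G) → Automorphism (toGraph G)
    restrict σ = record
      { to        = restrictTo σ
      ; from      = restrictTo (invᴬ _ σ)
      ; from-to   = restrictTo-inverse σ (invᴬ _ σ) (from-to σ)
      ; to-from   = restrictTo-inverse (invᴬ _ σ) σ (to-from σ)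
      ; preserves = restrictTo-preserves σ
      }

    liftTo-restrict : ∀ σ x → liftTo (restrict σ) x ≡ to σ x
    liftTo-restrict σ (inj₁ u) = sym (restrictTo-spec σ u)
    liftTo-restrict σ (inj₂ e) with edge↦edge σ e
    ... | e' , eq = trans (cong inj₂ (mapEdge-unique (restrict σ) e joins-image)) (sym eq)
      where
      incident-image : ∀ {z} → Incident z e → Incident (restrictTo σ z) e'
      incident-image {z} z∈e =
        subst₂ (CAdj G) (restrictTo-spec σ z) eq (preserves⇒ σ {inj₁ z} {inj₂ e} z∈e)
      joins-image : Joins e' (restrictTo σ (e₁ e)) (restrictTo σ (e₂ e))
      joins-image = incident⇒joins (ends-distinct e ∘ restrictTo-injective σ)
        (incident-image (inj₁ refl)) (incident-image (inj₂ refl))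

    lift-isGroupIsomorphism : GroupMorphisms.IsGroupIsomorphism
      (Group.rawGroup (Aut (toGraph G))) (Group.rawGroup (Aut (Central G))) lift
    lift-isGroupIsomorphism = record
      { isGroupMonomorphism = record
        { isGroupHomomorphism = record
          { isMonoidHomomorphism = record
            { isMagmaHomomorphism = record
              { isRelHomomorphism = record { cong = λ {f} {g} → liftTo-cong {f} {g} }
              ; homo = λ f g → liftTo-∘ {f} {g} {_∘ᴬ_ _ f g} (λ _ → refl)
              }
            ; ε-homo = liftTo-id {idᴬ _} (λ _ → refl)
            }
          ; ⁻¹-homo = λ _ _ → refl
          }
        ; injective = λ lift-f≈lift-g u → inj₁-injective (lift-f≈lift-g (inj₁ u))
        }
      ; surjective = λ σ → restrict σ , λ {f} f≈restrict-σ x →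
          trans (liftTo-cong {f} {restrict σ} f≈restrict-σ x) (liftTo-restrict σ x)
      }

lemma2p5 : (n : ℕ) → n ≥ 4 → (G : SimpleGraph n) → Connected G →
    Aut (toGraph G) ≅ᴳ Aut (Central G)
lemma2p5 n n≥4 G _ = lift G , lift-isGroupIsomorphism G n≥4
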